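{- Let $\mathbb{K}$ be a field of characteristic $0$, let $(\vartheta,\omega)\in\mathrm{BP}_n$, $m=\max\{\mathrm{len}(\vartheta),\mathrm{len}(\omega)\}$, and let $z=(\underbrace{0,\dots,0}_{\vartheta_1},\underbrace{a_1,\dots,a_1}_{\omega_1+\vartheta_2},\underbrace{a_2,\dots,a_2}_{\omega_2+\vartheta_3},\dots,\underbrace{a_m,\dots,a_m}_{\omega_m+\vartheta_{m+1}})\in\mathbb{K}^n$ with $a_i\neq0$ for all $i$ and $a_i^2\neq a_j^2$ for $i\neq j$. Then (i) $z\notin V_{(\vartheta,\omega)}$; (ii) if $(\lambda,\mu)\in\mathrm{BP}_n$ satisfies $z\notin V_{(\lambda,\mu)}$, then $\sum_{j=1}^{k-1}(\lambda_j+\mu_j)+\lambda_k\ge\sum_{j=1}^{k-1}(\vartheta_j+\omega_j)+\vartheta_k$ for every integer $k\ge1$.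
   Context: A partition is a non-increasing sequence of non-negative integers (zero beyond its length $\mathrm{len}$); $\mathrm{BP}_n$ is the set of pairs of partitions of total size $n$. A bitableau of shape $(\lambda,\mu)$ fills the pair of Young diagrams with $1,\dots,n$ each once; with $\Delta_{(i_1,\dots,i_r)}(\mathbf{y})=\prod_{j<k}(y_{i_j}-y_{i_k})$, its Specht polynomial is $\mathrm{sp}_{(T,S)}(\mathbf{x})=\prod_i\Delta_{T_i}(\mathbf{x}^2)\prod_j\Delta_{S_j}(\mathbf{x}^2)\prod_{k\in S}x_k$ ($T_i,S_j$ columns, $\mathbf{x}^2=(x_1^2,\dots,x_n^2)$). $V_{(\lambda,\mu)}\subset\mathbb{K}^n$ is the common zero set of all Specht polynomials of bitableaux of shape $(\lambda,\mu)$. -}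

module Defs where

open import Level using (Level; _⊔_)
open import Algebra.Bundles using (CommutativeRing)
open import Data.Nat using (ℕ; zero; suc; _+_; _∸_; _≤_; _<_; _≥_)
  renaming (_⊔_ to _⊔ℕ_)
open import Data.Fin using (Fin; toℕ)
open import Data.List using (List; []; _∷_; map; foldr; length; concat; _++_;
  replicate; applyUpTo; upTo; allFin; mapMaybe)
open import Data.Nat.ListAction using (sum)
open import Data.Maybe using (Maybe; just; nothing)
open import Data.List.Relation.Unary.All using (All)
open import Data.List.Relation.Unary.Linked using (Linked)
open import Data.List.Relation.Binary.Permutation.Propositional using (_↭_)
open import Data.Product using (_×_; ∃)
open import Relation.Nullary using (¬_)
open import Relation.Binary.PropositionalEquality using (_≡_)

-- Partitions, represented by the list of their nonzero parts
-- (λ₁ ≥ λ₂ ≥ … ≥ λ_len > 0); parts beyond the length are 0.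

IsPartition : List ℕ → Set
IsPartition ν = All (0 <_) ν × Linked _≥_ ν

len : List ℕ → ℕ
len = length

size : List ℕ → ℕ
size = sum

-- 1-indexed part ν_j (ν_j = 0 for j > len ν; index 0 is unused and gives 0)
part : List ℕ → ℕ → ℕ
part ν zero = 0
part [] (suc j) = 0
part (x ∷ ν) (suc zero) = x
part (x ∷ ν) (suc (suc j)) = part ν (suc j)

IsBP : ℕ → List ℕ → List ℕ → Set
IsBP n λ' μ = IsPartition λ' × IsPartition μ × size λ' + size μ ≡ n

-- Bitableaux of shape (λ , μ): fillings of the two diagrams, given row by
-- row (rows listed top to bottom, entries left to right), with the entries
-- 1,…,n (here the elements of Fin n), each used exactly once.

record Bitableau (n : ℕ) (λ' μ : List ℕ) : Set where
  field
    T      : List (List (Fin n))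
    S      : List (List (Fin n))
    shapeT : map length T ≡ λ'
    shapeS : map length S ≡ μ
    bij    : concat T ++ concat S ↭ allFin n

nth : ∀ {a} {A : Set a} → List A → ℕ → Maybe A
nth [] j = nothing
nth (x ∷ xs) zero = just x
nth (x ∷ xs) (suc j) = nth xs j

column : ∀ {n} → List (List (Fin n)) → ℕ → List (Fin n)
column rows j = mapMaybe (λ r → nth r j) rows

columns : ∀ {n} → List (List (Fin n)) → List (List (Fin n))
columns rows = map (column rows) (upTo (foldr _⊔ℕ_ 0 (map length rows)))

module _ {c ℓ : Level} (R : CommutativeRing c ℓ) where
  open CommutativeRing R renaming (_+_ to _+ᴿ_)

  IsField : Set (c ⊔ ℓ)
  IsField = (¬ (1# ≈ 0#)) × (∀ x → ¬ (x ≈ 0#) → ∃ λ y → x * y ≈ 1#)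

  natCast : ℕ → Carrier
  natCast zero = 0#
  natCast (suc k) = 1# +ᴿ natCast k

  CharZero : Set ℓ
  CharZero = ∀ k → ¬ (natCast (suc k) ≈ 0#)

  prod : List Carrier → Carrier
  prod = foldr _*_ 1#

  Δ : List Carrier → Carrier
  Δ [] = 1#
  Δ (y ∷ ys) = prod (map (λ y' → y +ᴿ (- y')) ys) * Δ ys

  sp : ∀ {n λ' μ} → Bitableau n λ' μ → (Fin n → Carrier) → Carrier
  sp {n} B x =
      prod (map (λ col → Δ (map x² col)) (columns T))
    * prod (map (λ col → Δ (map x² col)) (columns S))
    * prod (map x (concat S))
    where
      open Bitableau B
      x² : Fin n → Carrier
      x² i = x i * x i

  InV : (n : ℕ) → List ℕ → List ℕ → (Fin n → Carrier) → Set ℓ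
  InV n λ' μ x = (B : Bitableau n λ' μ) → sp B x ≈ 0#

  zList : List ℕ → List ℕ → (ℕ → Carrier) → List Carrier
  zList ϑ ω a =
    replicate (part ϑ 1) 0#
    ++ concat (applyUpTo (λ i → replicate (part ω (suc i) + part ϑ (suc (suc i))) (a (suc i)))
                         (len ϑ ⊔ℕ len ω))

  -- list lookup with default 0# (the list zList has length n = |ϑ|+|ω|)
  lookup0 : List Carrier → ℕ → Carrier
  lookup0 [] j = 0#
  lookup0 (x ∷ xs) zero = x
  lookup0 (x ∷ xs) (suc j) = lookup0 xs j

  zPoint : (n : ℕ) → List ℕ → List ℕ → (ℕ → Carrier) → (Fin n → Carrier)
  zPoint n ϑ ω a i = lookup0 (zList ϑ ω a) (toℕ i)

sumTo : (ℕ → ℕ) → ℕ → ℕ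
sumTo f zero = 0
sumTo f (suc k) = sumTo f k + f (suc k)

dom : List ℕ → List ℕ → ℕ → ℕ
dom λ' μ k = sumTo (λ j → part λ' j + part μ j) (k ∸ 1) + part λ' k

-- Give each position of z the class c of its block, so z = a_c with a₀ = 0 and
-- c ∈ {0, …, m}.  Then sp_(T,S)(z) = 0 whenever a column of T or S repeats a
-- class or an entry of S has class 0; otherwise, over a field, it is a product
-- of nonzero factors, since the a_c are nonzero with distinct squares.
-- (i) The bitableau whose i-th rows hold the positions of class i − 1 (in T) and
-- of class i (in S) has only strictly increasing column classes and no class 0
-- in S, so its Specht polynomial does not vanish at z.
-- (ii) If some sp_(T,S)(z) ≠ 0, a column of T (of S) has distinct classes ≥ 0
-- (≥ 1), so at most k of its entries lie below class k (class k + 1).  Hence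
-- the cells of T below row k and of S below row k − 1 number at most the count
-- C_k of positions of class ≥ k; for the canonical filling of shape (ϑ, ω) this
-- is an equality, and both cell counts are n minus the partial sums in (ii).

module Submission where

open import Defs
open import Level using (Level)
open import Algebra.Bundles using (CommutativeRing)
open import Data.Nat using (ℕ; zero; suc; _+_; _∸_; _≤_; _<_; _≥_; z≤n; s≤s; z<s; s<s; _≤?_; _≟_; _⊔_)
open import Data.Nat.Properties using (+-identityʳ; +-assoc; +-comm; +-suc; +-mono-≤; +-monoʳ-≤; +-∸-assoc; ≤-trans; ≤-reflexive; <⇒≤; <⇒≱; ≤∧≮⇒≡; ≰⇒>; m≤m⊔n; m≤n⊔m; m<m+n; m≤n⇒m≤1+n; m≤n⇒m∸n≡0; m≤n+o⇒m∸n≤o; <-irrefl; ≤-pred; +-cancelʳ-≤; +-commutativeSemigroup; module ≤-Reasoning)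
open import Algebra.Properties.CommutativeSemigroup +-commutativeSemigroup using (interchange)
open import Data.Nat.Tactic.RingSolver using (solve-∀)
open import Data.Nat.ListAction using (sum)
open import Data.Nat.ListAction.Properties using (sum-++; sum-↭)
open import Data.Fin using (Fin; toℕ)
open import Data.List using (List; []; _∷_; map; foldr; length; concat; _++_; replicate; applyUpTo; tabulate; upTo; allFin; take; drop; fromMaybe)
open import Data.List.Properties using (map-++; length-++; length-drop; drop-map; drop-[]; ∷-injectiveˡ; ∷-injectiveʳ; ++-assoc; map-∘; length-replicate; length-map; map-replicate; map-tabulate; map-applyUpTo; concat-map; take++drop≡id)
open import Data.List.Relation.Unary.All as All using (All; []; _∷_)
import Data.List.Relation.Unary.All.Properties as All
open import Data.List.Relation.Unary.AllPairs as AllPairs using (AllPairs; []; _∷_)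
import Data.List.Relation.Unary.AllPairs.Properties as AllPairs
open import Data.List.Relation.Unary.Linked as Linked using (Linked)
open import Data.List.Relation.Unary.Linked.Properties using (Linked⇒All)
open import Data.List.Relation.Binary.Permutation.Propositional using (_↭_; ↭-refl; ↭-trans; ↭-reflexive)
import Data.List.Relation.Binary.Permutation.Propositional.Properties as ↭
open import Data.Maybe using (just; nothing)
open import Data.Product using (_×_; _,_; proj₁; proj₂)
open import Data.Unit using (⊤; tt)
open import Data.Sum using (_⊎_; inj₁; inj₂; [_,_]; map₂)
open import Data.Empty using (⊥-elim)
open import Function using (_∘_; id; case_of_)
open import Relation.Nullary using (¬_; Dec; yes; no)
open import Relation.Binary.PropositionalEquality using (_≡_; _≢_; refl; sym; trans; cong; cong₂; subst; subst₂; module ≡-Reasoning)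

module _ {A : Set} where

  sumMap : (A → ℕ) → List A → ℕ
  sumMap f xs = sum (map f xs)

  sumMap-++ : ∀ f xs ys → sumMap f (xs ++ ys) ≡ sumMap f xs + sumMap f ys
  sumMap-++ f xs ys = trans (cong sum (map-++ f xs ys)) (sum-++ (map f xs) (map f ys))

  sumMap-1≡length : ∀ xs → sumMap (λ _ → 1) xs ≡ length xs
  sumMap-1≡length [] = refl
  sumMap-1≡length (x ∷ xs) = cong suc (sumMap-1≡length xs)

  sumMap-↭ : ∀ f {xs ys} → xs ↭ ys → sumMap f xs ≡ sumMap f ys
  sumMap-↭ f p = sum-↭ (↭.map⁺ f p)

applyUpTo-cong : ∀ {a} {A : Set a} {f g : ℕ → A} M → (∀ i → f i ≡ g i) → applyUpTo f M ≡ applyUpTo g M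
applyUpTo-cong zero f≗g = refl
applyUpTo-cong (suc M) f≗g = cong₂ _∷_ (f≗g 0) (applyUpTo-cong M (f≗g ∘ suc))

replicate-+ : ∀ {a} {A : Set a} m k (x : A) → replicate (m + k) x ≡ replicate m x ++ replicate k x
replicate-+ zero k x = refl
replicate-+ (suc m) k x = cong (x ∷_) (replicate-+ m k x)

AllPairs-All⁺ : ∀ {a p r} {A : Set a} {P : A → Set p} {R : A → A → Set r} {xs} →
  All P xs → AllPairs R xs → AllPairs (λ x y → R x y × P y) xs
AllPairs-All⁺ [] [] = []
AllPairs-All⁺ (_ ∷ ps) (rs ∷ rss) = All.zip (rs , ps) ∷ AllPairs-All⁺ ps rss

indicator : ∀ {p} {P : Set p} → Dec P → ℕ
indicator (yes _) = 1
indicator (no _) = 0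

sumBelow : (ℕ → ℕ) → ℕ → ℕ
sumBelow f zero = 0
sumBelow f (suc W) = f 0 + sumBelow (f ∘ suc) W

sumBelow-cong : ∀ {f g} W → (∀ j → f j ≡ g j) → sumBelow f W ≡ sumBelow g W
sumBelow-cong zero f≗g = refl
sumBelow-cong (suc W) f≗g = cong₂ _+_ (f≗g 0) (sumBelow-cong W (f≗g ∘ suc))

sumBelow-zero : ∀ {f} W → (∀ j → f j ≡ 0) → sumBelow f W ≡ 0
sumBelow-zero zero f≗0 = refl
sumBelow-zero (suc W) f≗0 = cong₂ _+_ (f≗0 0) (sumBelow-zero W (f≗0 ∘ suc))

sumBelow-+ : ∀ f g W → sumBelow (λ j → f j + g j) W ≡ sumBelow f W + sumBelow g W
sumBelow-+ f g zero = refl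
sumBelow-+ f g (suc W) =
  trans (cong (f 0 + g 0 +_) (sumBelow-+ (f ∘ suc) (g ∘ suc) W)) (interchange (f 0) (g 0) _ _)

sumBelow-mono : ∀ {f g} W → (∀ {j} → j < W → f j ≤ g j) → sumBelow f W ≤ sumBelow g W
sumBelow-mono zero f≤g = z≤n
sumBelow-mono (suc W) f≤g = +-mono-≤ (f≤g z<s) (sumBelow-mono W (f≤g ∘ s<s))

sumTo-+ : ∀ f g k → sumTo (λ j → f j + g j) k ≡ sumTo f k + sumTo g k
sumTo-+ f g zero = refl
sumTo-+ f g (suc k) =
  trans (cong (_+ (f (suc k) + g (suc k))) (sumTo-+ f g k)) (interchange (sumTo f k) (sumTo g k) _ _)

sumTo-part-∷ : ∀ x ν k → sumTo (part (x ∷ ν)) (suc k) ≡ x + sumTo (part ν) k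
sumTo-part-∷ x ν zero = sym (+-identityʳ x)
sumTo-part-∷ x ν (suc k) =
  trans (cong (_+ part ν (suc k)) (sumTo-part-∷ x ν k)) (+-assoc x (sumTo (part ν) k) _)

sumTo-part-[] : ∀ k → sumTo (part []) k ≡ 0
sumTo-part-[] zero = refl
sumTo-part-[] (suc k) = cong (_+ 0) (sumTo-part-[] k)

sumTo-part+sum-drop : ∀ ν k → sumTo (part ν) k + sum (drop k ν) ≡ size ν
sumTo-part+sum-drop ν zero = refl
sumTo-part+sum-drop [] (suc k) = cong (_+ 0) (sumTo-part-[] (suc k))
sumTo-part+sum-drop (x ∷ ν) (suc k) = begin
  sumTo (part (x ∷ ν)) (suc k) + sum (drop k ν) ≡⟨ cong (_+ sum (drop k ν)) (sumTo-part-∷ x ν k) ⟩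
  x + sumTo (part ν) k + sum (drop k ν)         ≡⟨ +-assoc x _ _ ⟩
  x + (sumTo (part ν) k + sum (drop k ν))       ≡⟨ cong (x +_) (sumTo-part+sum-drop ν k) ⟩
  x + size ν                                     ∎
  where open ≡-Reasoning

dom+tails≡size : ∀ λ' μ k →
  dom λ' μ (suc k) + (sum (drop (suc k) λ') + sum (drop k μ)) ≡ size λ' + size μ
dom+tails≡size λ' μ k = begin
  sumTo (λ j → part λ' j + part μ j) k + part λ' (suc k) + (Dλ + Dμ)
    ≡⟨ cong (λ t → t + part λ' (suc k) + (Dλ + Dμ)) (sumTo-+ (part λ') (part μ) k) ⟩
  Sλ + Sμ + part λ' (suc k) + (Dλ + Dμ)
    ≡⟨ shuffle Sλ Sμ (part λ' (suc k)) Dλ Dμ ⟩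
  (Sλ + part λ' (suc k)) + Dλ + (Sμ + Dμ)
    ≡⟨ cong₂ _+_ (sumTo-part+sum-drop λ' (suc k)) (sumTo-part+sum-drop μ k) ⟩
  size λ' + size μ ∎
  where
  open ≡-Reasoning
  Sλ = sumTo (part λ') k
  Sμ = sumTo (part μ) k
  Dλ = sum (drop (suc k) λ')
  Dμ = sum (drop k μ)
  shuffle : ∀ a b c d e → a + b + c + (d + e) ≡ a + c + d + (b + e)
  shuffle = solve-∀

part-drop-1 : ∀ ν i → part ν (suc (suc i)) ≡ part (drop 1 ν) (suc i)
part-drop-1 [] i = refl
part-drop-1 (x ∷ ν) i = refl

len-drop-1 : ∀ ν {M} → len ν ≤ suc M → len (drop 1 ν) ≤ M
len-drop-1 ν {M} l = subst (_≤ M) (sym (length-drop 1 ν)) (m≤n+o⇒m∸n≤o (len ν) 1 l)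

-- Columns of a filling
module _ {n : ℕ} where

  Rows : Set
  Rows = List (List (Fin n))

  width : Rows → ℕ
  width R = foldr _⊔_ 0 (map length R)

  length≤width : ∀ R → All (λ r → length r ≤ width R) R
  length≤width [] = []
  length≤width (r ∷ R) =
    m≤m⊔n (length r) (width R) ∷ All.map (λ l → ≤-trans l (m≤n⊔m (length r) (width R))) (length≤width R)

  nth-short : ∀ (r : List (Fin n)) j → length r ≤ j → nth r j ≡ nothing
  nth-short [] j _ = refl
  nth-short (x ∷ r) (suc j) (s≤s l) = nth-short r j l

  nth-nothing⇒short : ∀ (r : List (Fin n)) j → nth r j ≡ nothing → length r ≤ j
  nth-nothing⇒short [] j _ = z≤n
  nth-nothing⇒short (x ∷ r) (suc j) e = s≤s (nth-nothing⇒short r j e)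

  nth-All : ∀ {p} {P : Fin n → Set p} (r : List (Fin n)) j {x} → nth r j ≡ just x → All P r → P x
  nth-All (y ∷ r) zero refl (p ∷ _) = p
  nth-All (y ∷ r) (suc j) e (_ ∷ ps) = nth-All r j e ps

  column-∷ : ∀ (r : List (Fin n)) R j → column (r ∷ R) j ≡ fromMaybe (nth r j) ++ column R j
  column-∷ r R j with nth r j
  ... | just x = refl
  ... | nothing = refl

  All-column : ∀ {p} {P : Fin n → Set p} R j → All P (concat R) → All P (column R j)
  All-column [] j _ = []
  All-column (r ∷ R) j ps with All.++⁻ r ps | nth r j in eq
  ... | _ , psR | nothing = All-column R j psR
  ... | psr , psR | just x = nth-All r j eq psr ∷ All-column R j psR

  column-short : ∀ R j → All (λ r → length r ≤ j) R → column R j ≡ []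
  column-short [] j [] = refl
  column-short (r ∷ R) j (l ∷ ls) rewrite nth-short r j l = column-short R j ls

  Descending : Rows → Set
  Descending R = Linked _≥_ (map length R)

  -- As row lengths decrease, the rows meeting column j form an initial segment of the rows.
  column-drop : ∀ R k j → Descending R → column (drop k R) j ≡ drop k (column R j)
  column-drop R zero j _ = refl
  column-drop [] (suc k) j _ = refl
  column-drop (r ∷ R) (suc k) j desc with nth r j in eq
  ... | just x = column-drop R k j (Linked.tail desc)
  ... | nothing =
    trans (column-short (drop k R) j (All.drop⁺ k shortR)) (cong (drop (suc k)) (sym (column-short R j shortR)))
    where
    shortR : All (λ r' → length r' ≤ j) R
    shortR = All.map⁻ (All.tail (Linked⇒All (λ p q → ≤-trans q p) (nth-nothing⇒short r j eq) desc))

  sumBelow-nth : ∀ g (r : List (Fin n)) W → length r ≤ W →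
    sumBelow (λ j → sumMap g (fromMaybe (nth r j))) W ≡ sumMap g r
  sumBelow-nth g [] W _ = sumBelow-zero W (λ _ → refl)
  sumBelow-nth g (x ∷ r) (suc W) (s≤s l) = cong₂ _+_ (+-identityʳ (g x)) (sumBelow-nth g r W l)

  sumBelow-columns : ∀ g R W → All (λ r → length r ≤ W) R →
    sumBelow (λ j → sumMap g (column R j)) W ≡ sumMap g (concat R)
  sumBelow-columns g [] W _ = sumBelow-zero W (λ _ → refl)
  sumBelow-columns g (r ∷ R) W (l ∷ ls) = begin
    sumBelow (λ j → sumMap g (column (r ∷ R) j)) W
      ≡⟨ sumBelow-cong W (λ j → trans (cong (sumMap g) (column-∷ r R j))
                                      (sumMap-++ g (fromMaybe (nth r j)) (column R j))) ⟩
    sumBelow (λ j → sumMap g (fromMaybe (nth r j)) + sumMap g (column R j)) W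
      ≡⟨ sumBelow-+ _ _ W ⟩
    sumBelow (λ j → sumMap g (fromMaybe (nth r j))) W + sumBelow (λ j → sumMap g (column R j)) W
      ≡⟨ cong₂ _+_ (sumBelow-nth g r W l) (sumBelow-columns g R W ls) ⟩
    sumMap g r + sumMap g (concat R)
      ≡⟨ sumMap-++ g r (concat R) ⟨
    sumMap g (concat (r ∷ R)) ∎
    where open ≡-Reasoning

  All-columns⁺ : ∀ {p} {P : List (Fin n) → Set p} R → (∀ j → P (column R j)) → All P (columns R)
  All-columns⁺ R p = All.map⁺ (All.universal p (upTo (width R)))

  All-columns⁻ : ∀ {p} {P : List (Fin n) → Set p} R → All P (columns R) →
    ∀ {j} → j < width R → P (column R j)
  All-columns⁻ R ps = All.applyUpTo⁻ id (width R) (All.map⁻ ps)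

  sumMap-length-drop : ∀ {ν} (R : Rows) → map length R ≡ ν →
    ∀ j → sumMap length (drop j R) ≡ sum (drop j ν)
  sumMap-length-drop R shape j = cong sum (trans (sym (drop-map j R)) (cong (drop j) shape))

  length-concat : ∀ (R : Rows) → length (concat R) ≡ sumMap length R
  length-concat [] = refl
  length-concat (r ∷ R) = trans (length-++ r) (cong (length r +_) (length-concat R))

  cells≡sumBelow-columns : ∀ R W → All (λ r → length r ≤ W) R →
    sumMap length R ≡ sumBelow (λ j → length (column R j)) W
  cells≡sumBelow-columns R W ls = begin
    sumMap length R                                  ≡⟨ length-concat R ⟨
    length (concat R)                                ≡⟨ sumMap-1≡length (concat R) ⟨
    sumMap (λ _ → 1) (concat R)                      ≡⟨ sumBelow-columns (λ _ → 1) R W ls ⟨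
    sumBelow (λ j → sumMap (λ _ → 1) (column R j)) W ≡⟨ sumBelow-cong W (λ j → sumMap-1≡length (column R j)) ⟩
    sumBelow (λ j → length (column R j)) W           ∎
    where open ≡-Reasoning

-- The class list of the point z: ϑ₁ zeros, then for s = 1, 2, … the value s
-- repeated ω_s + ϑ_{s+1} times; classBlocks μ λ' s is the part from class s on,
-- with λ' standing for ϑ shifted by one row.
classBlocks : List ℕ → List ℕ → ℕ → List ℕ
classBlocks (y ∷ μ) (x ∷ λ') s = replicate y s ++ replicate x s ++ classBlocks μ λ' (suc s)
classBlocks (y ∷ μ) []       s = replicate y s ++ classBlocks μ [] (suc s)
classBlocks []      (x ∷ λ') s = replicate x s ++ classBlocks [] λ' (suc s)
classBlocks []      []       s = []

classList : List ℕ → List ℕ → List ℕ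
classList ϑ ω = replicate (part ϑ 1) 0 ++ classBlocks ω (drop 1 ϑ) 1

classBlocks-step : ∀ μ λ' s →
  classBlocks μ λ' s ≡ replicate (part μ 1 + part λ' 1) s ++ classBlocks (drop 1 μ) (drop 1 λ') (suc s)
classBlocks-step (y ∷ μ) (x ∷ λ') s = sym (trans (cong (_++ _) (replicate-+ y x s)) (++-assoc (replicate y s) _ _))
classBlocks-step (y ∷ μ) [] s = cong (λ k → replicate k s ++ _) (sym (+-identityʳ y))
classBlocks-step [] (x ∷ λ') s = refl
classBlocks-step [] [] s = refl

classBlocks≡concat : ∀ M μ λ' s → len μ ≤ M → len λ' ≤ M →
  concat (applyUpTo (λ i → replicate (part μ (suc i) + part λ' (suc i)) (s + i)) M) ≡ classBlocks μ λ' s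
classBlocks≡concat zero [] [] s _ _ = refl
classBlocks≡concat (suc M) μ λ' s lμ lλ = begin
  replicate (part μ 1 + part λ' 1) (s + 0)
    ++ concat (applyUpTo (λ i → replicate (part μ (2 + i) + part λ' (2 + i)) (s + suc i)) M)
    ≡⟨ cong₂ _++_ (cong (replicate _) (+-identityʳ s))
         (cong concat (applyUpTo-cong M (λ i → cong₂ replicate
           (cong₂ _+_ (part-drop-1 μ i) (part-drop-1 λ' i)) (+-suc s i)))) ⟩
  replicate (part μ 1 + part λ' 1) s
    ++ concat (applyUpTo (λ i → replicate (part (drop 1 μ) (suc i) + part (drop 1 λ') (suc i)) (suc s + i)) M)
    ≡⟨ cong (_ ++_) (classBlocks≡concat M (drop 1 μ) (drop 1 λ') (suc s) (len-drop-1 μ lμ) (len-drop-1 λ' lλ)) ⟩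
  replicate (part μ 1 + part λ' 1) s ++ classBlocks (drop 1 μ) (drop 1 λ') (suc s)
    ≡⟨ classBlocks-step μ λ' s ⟨
  classBlocks μ λ' s ∎
  where open ≡-Reasoning

length-classBlocks : ∀ μ λ' s → length (classBlocks μ λ' s) ≡ size μ + size λ'
length-classBlocks (y ∷ μ) (x ∷ λ') s = begin
  length (replicate y s ++ replicate x s ++ classBlocks μ λ' (suc s))
    ≡⟨ length-++ (replicate y s) ⟩
  length (replicate y s) + length (replicate x s ++ classBlocks μ λ' (suc s))
    ≡⟨ cong₂ _+_ (length-replicate y) (trans (length-++ (replicate x s))
         (cong₂ _+_ (length-replicate x) (length-classBlocks μ λ' (suc s)))) ⟩
  y + (x + (size μ + size λ'))
    ≡⟨ +-assoc y x _ ⟨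
  y + x + (size μ + size λ')
    ≡⟨ interchange y x (size μ) (size λ') ⟩
  y + size μ + (x + size λ') ∎
  where open ≡-Reasoning
length-classBlocks (y ∷ μ) [] s = trans (length-++ (replicate y s))
  (trans (cong₂ _+_ (length-replicate y) (length-classBlocks μ [] (suc s)))
    (sym (+-assoc y (size μ) 0)))
length-classBlocks [] (x ∷ λ') s = trans (length-++ (replicate x s))
  (cong₂ _+_ (length-replicate x) (length-classBlocks [] λ' (suc s)))
length-classBlocks [] [] s = refl

length-classList : ∀ ϑ ω → length (classList ϑ ω) ≡ size ϑ + size ω
length-classList ϑ ω = begin
  length (replicate (part ϑ 1) 0 ++ classBlocks ω (drop 1 ϑ) 1)
    ≡⟨ length-++ (replicate (part ϑ 1) 0) ⟩
  length (replicate (part ϑ 1) 0) + length (classBlocks ω (drop 1 ϑ) 1)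
    ≡⟨ cong₂ _+_ (length-replicate (part ϑ 1)) (length-classBlocks ω (drop 1 ϑ) 1) ⟩
  part ϑ 1 + (size ω + size (drop 1 ϑ))
    ≡⟨ cong (part ϑ 1 +_) (+-comm (size ω) _) ⟩
  part ϑ 1 + (size (drop 1 ϑ) + size ω)
    ≡⟨ +-assoc (part ϑ 1) _ _ ⟨
  part ϑ 1 + size (drop 1 ϑ) + size ω
    ≡⟨ cong (_+ size ω) (sumTo-part+sum-drop ϑ 1) ⟩
  size ϑ + size ω ∎
  where open ≡-Reasoning

lookupℕ : List ℕ → ℕ → ℕ
lookupℕ []      j       = 0
lookupℕ (c ∷ L) zero    = c
lookupℕ (c ∷ L) (suc j) = lookupℕ L j

tabulate-lookupℕ : ∀ {n} L → length L ≡ n → tabulate (λ (i : Fin n) → lookupℕ L (toℕ i)) ≡ L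
tabulate-lookupℕ [] refl = refl
tabulate-lookupℕ (c ∷ L) refl = cong (c ∷_) (tabulate-lookupℕ L refl)

-- The canonical filling: row i of T holds the positions of class i − 1 and row i
-- of S those of class i, cut out of a list laid out as classBlocks or classList.
module _ {A : Set} where

  cutT : List ℕ → List ℕ → List A → List (List A)
  cutT μ       []       l = []
  cutT (y ∷ μ) (x ∷ λ') l = take x (drop y l) ∷ cutT μ λ' (drop x (drop y l))
  cutT []      (x ∷ λ') l = take x l ∷ cutT [] λ' (drop x l)

  cutS : List ℕ → List ℕ → List A → List (List A)
  cutS []      λ'       l = []
  cutS (y ∷ μ) (x ∷ λ') l = take y l ∷ cutS μ λ' (drop x (drop y l))
  cutS (y ∷ μ) []       l = take y l ∷ cutS μ [] (drop y l)

  canonicalT : List ℕ → List ℕ → List A → List (List A)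
  canonicalT []      ω l = []
  canonicalT (x ∷ ϑ) ω l = take x l ∷ cutT ω ϑ (drop x l)

  canonicalS : List ℕ → List ℕ → List A → List (List A)
  canonicalS []      ω l = cutS ω [] l
  canonicalS (x ∷ ϑ) ω l = cutS ω ϑ (drop x l)

-- Counting positions by class
module Classes {n : ℕ} (cls : Fin n → ℕ) where

  Distinct : List (Fin n) → Set
  Distinct = AllPairs (λ u v → cls u ≢ cls v)

  countFrom : ℕ → List (Fin n) → ℕ
  countFrom t = sumMap (λ x → indicator (t ≤? cls x))

  countFrom-all : ∀ {t} xs → All (λ x → t ≤ cls x) xs → countFrom t xs ≡ length xs
  countFrom-all [] [] = refl
  countFrom-all {t} (x ∷ xs) (p ∷ ps) with t ≤? cls x
  ... | yes _ = cong suc (countFrom-all xs ps)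
  ... | no ¬p = ⊥-elim (¬p p)

  countFrom-none : ∀ {t} xs → All (λ x → cls x < t) xs → countFrom t xs ≡ 0
  countFrom-none [] [] = refl
  countFrom-none {t} (x ∷ xs) (p ∷ ps) with t ≤? cls x
  ... | yes q = ⊥-elim (<⇒≱ p q)
  ... | no _ = countFrom-none xs ps

  countFrom-skip : ∀ {t} xs → All (λ x → cls x ≢ t) xs → countFrom t xs ≡ countFrom (suc t) xs
  countFrom-skip [] [] = refl
  countFrom-skip {t} (x ∷ xs) (p ∷ ps) with t ≤? cls x | suc t ≤? cls x
  ... | yes _ | yes _ = cong suc (countFrom-skip xs ps)
  ... | yes q | no ¬q = ⊥-elim (p (sym (≤∧≮⇒≡ q ¬q)))
  ... | no ¬q | yes q = ⊥-elim (¬q (<⇒≤ q))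
  ... | no _ | no _ = countFrom-skip xs ps

  -- In a list of distinct classes at most one element has class exactly t.
  countFrom≤suc-countFrom-suc : ∀ {t} xs → Distinct xs → countFrom t xs ≤ suc (countFrom (suc t) xs)
  countFrom≤suc-countFrom-suc [] [] = z≤n
  countFrom≤suc-countFrom-suc {t} (x ∷ xs) (p ∷ ps) with t ≤? cls x | suc t ≤? cls x
  ... | yes _ | yes _ = s≤s (countFrom≤suc-countFrom-suc xs ps)
  ... | yes q | no ¬q =
    s≤s (≤-reflexive (countFrom-skip xs (All.map (λ ne e → ne (trans (sym t≡cls) (sym e))) p)))
    where t≡cls = ≤∧≮⇒≡ q ¬q
  ... | no ¬q | yes q = ⊥-elim (¬q (<⇒≤ q))
  ... | no _ | no _ = countFrom≤suc-countFrom-suc xs ps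

  length≤+countFrom : ∀ {b} xs → Distinct xs → All (λ x → b ≤ cls x) xs →
    ∀ k → length xs ≤ k + countFrom (k + b) xs
  length≤+countFrom xs _ b≤ zero = ≤-reflexive (sym (countFrom-all xs b≤))
  length≤+countFrom {b} xs distinct b≤ (suc k) = begin
    length xs                                 ≤⟨ length≤+countFrom xs distinct b≤ k ⟩
    k + countFrom (k + b) xs                  ≤⟨ +-monoʳ-≤ k (countFrom≤suc-countFrom-suc xs distinct) ⟩
    k + suc (countFrom (suc k + b) xs)        ≡⟨ +-suc k _ ⟩
    suc k + countFrom (suc k + b) xs          ∎
    where open ≤-Reasoning

  length-drop≤countFrom : ∀ {b} xs → Distinct xs → All (λ x → b ≤ cls x) xs →
    ∀ k → length (drop k xs) ≤ countFrom (k + b) xs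
  length-drop≤countFrom xs distinct b≤ k = begin
    length (drop k xs) ≡⟨ length-drop k xs ⟩
    length xs ∸ k      ≤⟨ m≤n+o⇒m∸n≤o (length xs) k (length≤+countFrom xs distinct b≤ k) ⟩
    countFrom (k + _) xs ∎
    where open ≤-Reasoning

  cells-drop≤countFrom : ∀ {b} R → Descending R →
    (∀ {j} → j < width R → Distinct (column R j) × All (λ x → b ≤ cls x) (column R j)) →
    ∀ k → sumMap length (drop k R) ≤ countFrom (k + b) (concat R)
  cells-drop≤countFrom {b} R desc good k = begin
    sumMap length (drop k R)
      ≡⟨ cells≡sumBelow-columns (drop k R) W (All.drop⁺ k (length≤width R)) ⟩
    sumBelow (λ j → length (column (drop k R) j)) W
      ≡⟨ sumBelow-cong W (λ j → cong length (column-drop R k j desc)) ⟩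
    sumBelow (λ j → length (drop k (column R j))) W
      ≤⟨ sumBelow-mono W (λ j<W → length-drop≤countFrom _ (proj₁ (good j<W)) (proj₂ (good j<W)) k) ⟩
    sumBelow (λ j → countFrom (k + b) (column R j)) W
      ≡⟨ sumBelow-columns _ R W (length≤width R) ⟩
    countFrom (k + b) (concat R) ∎
    where
    open ≤-Reasoning
    W = width R

  Stratified : ℕ → Rows → Set
  Stratified s [] = ⊤
  Stratified s (r ∷ R) = All (λ x → cls x ≡ s) r × Stratified (suc s) R

  stratified-bounds : ∀ s R → Stratified s R → All (λ x → s ≤ cls x × cls x < s + length R) (concat R)
  stratified-bounds s [] _ = []
  stratified-bounds s (r ∷ R) (rs , Rs) = All.++⁺
    (All.map (λ e → ≤-reflexive (sym e) , subst (_< s + suc (length R)) (sym e) (m<m+n s z<s)) rs)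
    (All.map (λ {x} (lo , hi) → <⇒≤ lo , subst (cls x <_) (sym (+-suc s (length R))) hi)
             (stratified-bounds (suc s) R Rs))

  column-increasing : ∀ s R → Stratified s R → ∀ j → AllPairs (λ u v → cls u < cls v) (column R j)
  column-increasing s [] _ j = []
  column-increasing s (r ∷ R) (rs , Rs) j with nth r j in eq
  ... | nothing = column-increasing (suc s) R Rs j
  ... | just x =
    All.map (λ (lo , _) → subst (_< _) (sym (nth-All r j eq rs)) lo)
            (All-column R j (stratified-bounds (suc s) R Rs))
    ∷ column-increasing (suc s) R Rs j

  countFrom-stratified : ∀ s R → Stratified s R →
    ∀ t → countFrom t (concat R) ≡ sumMap length (drop (t ∸ s) R)
  countFrom-stratified s [] _ t = cong (sumMap length) (sym (drop-[] (t ∸ s)))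
  countFrom-stratified s (r ∷ R) (rs , Rs) t with t ≤? s
  ... | yes t≤s = begin
    countFrom t (r ++ concat R)
      ≡⟨ sumMap-++ _ r (concat R) ⟩
    countFrom t r + countFrom t (concat R)
      ≡⟨ cong₂ _+_ (countFrom-all r (All.map (λ e → subst (t ≤_) (sym e) t≤s) rs))
                   (countFrom-stratified (suc s) R Rs t) ⟩
    length r + sumMap length (drop (t ∸ suc s) R)
      ≡⟨ cong (λ i → length r + sumMap length (drop i R)) (m≤n⇒m∸n≡0 (m≤n⇒m≤1+n t≤s)) ⟩
    sumMap length (r ∷ R)
      ≡⟨ cong (λ i → sumMap length (drop i (r ∷ R))) (m≤n⇒m∸n≡0 t≤s) ⟨
    sumMap length (drop (t ∸ s) (r ∷ R)) ∎
    where open ≡-Reasoning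
  ... | no t≰s = begin
    countFrom t (r ++ concat R)
      ≡⟨ sumMap-++ _ r (concat R) ⟩
    countFrom t r + countFrom t (concat R)
      ≡⟨ cong₂ _+_ (countFrom-none r (All.map (λ e → subst (_< t) (sym e) (≰⇒> t≰s)) rs))
                   (countFrom-stratified (suc s) R Rs t) ⟩
    sumMap length (drop (t ∸ suc s) R)
      ≡⟨ cong (λ i → sumMap length (drop i (r ∷ R))) (+-∸-assoc 1 (≰⇒> t≰s)) ⟨
    sumMap length (drop (t ∸ s) (r ∷ R)) ∎
    where open ≡-Reasoning

  record Filling (sT sS : ℕ) (λ' μ : List ℕ) (T S : Rows) (l : List (Fin n)) : Set where
    field
      stratifiedT : Stratified sT T
      stratifiedS : Stratified sS S
      shapeT      : map length T ≡ λ'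
      shapeS      : map length S ≡ μ
      cells       : concat T ++ concat S ↭ l

  replicate-prefix : ∀ y {s R} (l : List (Fin n)) → map cls l ≡ replicate y s ++ R →
    All (λ x → cls x ≡ s) (take y l) × length (take y l) ≡ y × map cls (drop y l) ≡ R
  replicate-prefix zero l e = [] , refl , e
  replicate-prefix (suc y) (x ∷ l) e with replicate-prefix y l (∷-injectiveʳ e)
  ... | prefix , len , rest = ∷-injectiveˡ e ∷ prefix , cong suc len , rest

  private
    interleave : ∀ (P Q T S : List (Fin n)) → (Q ++ T) ++ (P ++ S) ↭ P ++ Q ++ T ++ S
    interleave P Q T S = ↭-trans (↭-reflexive (++-assoc Q T (P ++ S)))
                           (↭-trans (↭.++⁺ˡ Q (↭.shifts T P)) (↭.shifts Q P))

  cut-filling : ∀ μ λ' s l → map cls l ≡ classBlocks μ λ' s →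
    Filling s s λ' μ (cutT μ λ' l) (cutS μ λ' l) l
  cut-filling [] [] s [] _ = record
    { stratifiedT = tt ; stratifiedS = tt ; shapeT = refl ; shapeS = refl ; cells = ↭-refl }
  cut-filling (y ∷ μ) (x ∷ λ') s l e
    with replicate-prefix y l e
  ... | rowS , lenS , e′ with replicate-prefix x (drop y l) e′
  ... | rowT , lenT , e″ with cut-filling μ λ' (suc s) (drop x (drop y l)) e″
  ... | F = record
    { stratifiedT = rowT , stratifiedT
    ; stratifiedS = rowS , stratifiedS
    ; shapeT = cong₂ _∷_ lenT shapeT
    ; shapeS = cong₂ _∷_ lenS shapeS
    ; cells = ↭-trans (interleave (take y l) (take x (drop y l)) _ _)
        (↭-trans (↭.++⁺ˡ (take y l) (↭.++⁺ˡ (take x (drop y l)) cells))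
          (↭-reflexive (trans (cong (take y l ++_) (take++drop≡id x (drop y l))) (take++drop≡id y l))))
    }
    where open Filling F
  cut-filling (y ∷ μ) [] s l e
    with replicate-prefix y l e
  ... | rowS , lenS , e′ with cut-filling μ [] (suc s) (drop y l) e′
  ... | F = record
    { stratifiedT = tt
    ; stratifiedS = rowS , stratifiedS
    ; shapeT = refl
    ; shapeS = cong₂ _∷_ lenS shapeS
    ; cells = ↭-trans (↭.++⁺ˡ (take y l) cells) (↭-reflexive (take++drop≡id y l))
    }
    where open Filling F
  cut-filling [] (x ∷ λ') s l e
    with replicate-prefix x l e
  ... | rowT , lenT , e′ with cut-filling [] λ' (suc s) (drop x l) e′
  ... | F = record
    { stratifiedT = rowT , stratifiedT
    ; stratifiedS = tt
    ; shapeT = cong₂ _∷_ lenT shapeT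
    ; shapeS = refl
    ; cells = ↭-trans (↭-reflexive (++-assoc (take x l) _ _))
        (↭-trans (↭.++⁺ˡ (take x l) cells) (↭-reflexive (take++drop≡id x l)))
    }
    where open Filling F

  canonical-filling : ∀ ϑ ω l → map cls l ≡ classList ϑ ω →
    Filling 0 1 ϑ ω (canonicalT ϑ ω l) (canonicalS ϑ ω l) l
  canonical-filling [] ω l e with cut-filling ω [] 1 l e
  ... | F = record
    { stratifiedT = tt
    ; stratifiedS = stratifiedS
    ; shapeT = refl
    ; shapeS = shapeS
    ; cells = cells
    }
    where open Filling F
  canonical-filling (x ∷ ϑ) ω l e with replicate-prefix x l e
  ... | rowT , lenT , e′ with cut-filling ω ϑ 1 (drop x l) e′
  ... | F = record
    { stratifiedT = rowT , stratifiedT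
    ; stratifiedS = stratifiedS
    ; shapeT = cong₂ _∷_ lenT shapeT
    ; shapeS = shapeS
    ; cells = ↭-trans (↭-reflexive (++-assoc (take x l) _ _))
        (↭-trans (↭.++⁺ˡ (take x l) cells) (↭-reflexive (take++drop≡id x l)))
    }
    where open Filling F

-- Products over a field
module _ {c ℓ : Level} (K : CommutativeRing c ℓ) where
  open CommutativeRing K hiding (reflexive)
    renaming (_+_ to _+ᴷ_; refl to ≈-refl; sym to ≈-sym; trans to ≈-trans)
  open import Algebra.Properties.Group +-group using (x∙y⁻¹≈ε⇒x≈y; x≈y⇒x∙y⁻¹≈ε)

  x≈0⇒x*y≈0 : ∀ {x y} → x ≈ 0# → x * y ≈ 0#
  x≈0⇒x*y≈0 {x} {y} x≈0 = ≈-trans (*-cong x≈0 ≈-refl) (zeroˡ y)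

  y≈0⇒x*y≈0 : ∀ {x y} → y ≈ 0# → x * y ≈ 0#
  y≈0⇒x*y≈0 {x} {y} y≈0 = ≈-trans (*-cong ≈-refl y≈0) (zeroʳ x)

  prod-vanishes-unless-All : ∀ {a p} {A : Set a} {P : A → Set p} (f : A → Carrier) →
    (∀ x → P x ⊎ f x ≈ 0#) → ∀ xs → All P xs ⊎ prod K (map f xs) ≈ 0#
  prod-vanishes-unless-All f dec [] = inj₁ []
  prod-vanishes-unless-All f dec (x ∷ xs) with dec x | prod-vanishes-unless-All f dec xs
  ... | inj₂ fx≈0 | _          = inj₂ (x≈0⇒x*y≈0 fx≈0)
  ... | inj₁ _    | inj₂ rest≈0 = inj₂ (y≈0⇒x*y≈0 rest≈0)
  ... | inj₁ px   | inj₁ pxs   = inj₁ (px ∷ pxs)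

  Δ-vanishes-unless-AllPairs : ∀ {a r} {A : Set a} {R : A → A → Set r} (f : A → Carrier) →
    (∀ x y → R x y ⊎ f x ≈ f y) → ∀ xs → AllPairs R xs ⊎ Δ K (map f xs) ≈ 0#
  Δ-vanishes-unless-AllPairs f dec [] = inj₁ []
  Δ-vanishes-unless-AllPairs f dec (x ∷ xs)
    with prod-vanishes-unless-All (λ y → f x +ᴷ - f y) (λ y → map₂ x≈y⇒x∙y⁻¹≈ε (dec x y)) xs
       | Δ-vanishes-unless-AllPairs f dec xs
  ... | inj₂ head≈0 | _ = inj₂ (x≈0⇒x*y≈0 (subst (λ ys → prod K ys ≈ 0#) (map-∘ xs) head≈0))
  ... | inj₁ _  | inj₂ rest≈0 = inj₂ (y≈0⇒x*y≈0 rest≈0)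
  ... | inj₁ px | inj₁ pxs    = inj₁ (px ∷ pxs)

  module _ (isField : IsField K) where

    *-nonzero : ∀ {x y} → ¬ x ≈ 0# → ¬ y ≈ 0# → ¬ x * y ≈ 0#
    *-nonzero {x} {y} x≉0 y≉0 xy≈0 with proj₂ isField x x≉0
    ... | x⁻¹ , xx⁻¹≈1 = y≉0 (begin
      y              ≈⟨ *-identityˡ y ⟨
      1# * y         ≈⟨ *-cong (≈-trans (≈-sym xx⁻¹≈1) (*-comm x x⁻¹)) ≈-refl ⟩
      x⁻¹ * x * y    ≈⟨ *-assoc x⁻¹ x y ⟩
      x⁻¹ * (x * y)  ≈⟨ *-cong ≈-refl xy≈0 ⟩
      x⁻¹ * 0#       ≈⟨ zeroʳ x⁻¹ ⟩
      0#             ∎)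
      where open import Relation.Binary.Reasoning.Setoid setoid

    prod-nonzero : ∀ {a} {A : Set a} (f : A → Carrier) xs →
      All (λ x → ¬ f x ≈ 0#) xs → ¬ prod K (map f xs) ≈ 0#
    prod-nonzero f [] [] = proj₁ isField
    prod-nonzero f (x ∷ xs) (fx≉0 ∷ fxs≉0) = *-nonzero fx≉0 (prod-nonzero f xs fxs≉0)

    Δ-nonzero : ∀ ys → AllPairs (λ u v → ¬ u ≈ v) ys → ¬ Δ K ys ≈ 0#
    Δ-nonzero [] [] = proj₁ isField
    Δ-nonzero (y ∷ ys) (y≉ys ∷ distinct) = *-nonzero
      (prod-nonzero (λ y' → y +ᴷ - y') ys (All.map (λ y≉y' e → y≉y' (x∙y⁻¹≈ε⇒x≈y _ _ e)) y≉ys))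
      (Δ-nonzero ys distinct)

module _ {c ℓ : Level} (K : CommutativeRing c ℓ) (a : ℕ → CommutativeRing.Carrier K) where
  open CommutativeRing K using (Carrier; 0#)

  -- The coordinate of z at a position of class k (with a₀ = 0).
  value : ℕ → Carrier
  value zero    = 0#
  value (suc k) = a (suc k)

  lookup0-map-value : ∀ L j → lookup0 K (map value L) j ≡ value (lookupℕ L j)
  lookup0-map-value []      j       = refl
  lookup0-map-value (k ∷ L) zero    = refl
  lookup0-map-value (k ∷ L) (suc j) = lookup0-map-value L j

  zList≡map-value : ∀ ϑ ω → zList K ϑ ω a ≡ map value (classList ϑ ω)
  zList≡map-value ϑ ω = sym (begin
    map value (replicate (part ϑ 1) 0 ++ classBlocks ω (drop 1 ϑ) 1)
      ≡⟨ map-++ value (replicate (part ϑ 1) 0) _ ⟩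
    map value (replicate (part ϑ 1) 0) ++ map value (classBlocks ω (drop 1 ϑ) 1)
      ≡⟨ cong₂ _++_ (map-replicate value (part ϑ 1) 0)
           (cong (map value) (sym (classBlocks≡concat M ω (drop 1 ϑ) 1 (m≤n⊔m (len ϑ) (len ω))
                                     (len-drop-1 ϑ (m≤n⇒m≤1+n (m≤m⊔n (len ϑ) (len ω))))))) ⟩
    replicate (part ϑ 1) 0# ++ map value (concat (applyUpTo (λ i → replicate (blockLength i) (suc i)) M))
      ≡⟨ cong (_ ++_) (concat-map (applyUpTo (λ i → replicate (blockLength i) (suc i)) M)) ⟨
    replicate (part ϑ 1) 0# ++ concat (map (map value) (applyUpTo (λ i → replicate (blockLength i) (suc i)) M))
      ≡⟨ cong (λ xss → _ ++ concat xss) (map-applyUpTo _ (map value) M) ⟩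
    replicate (part ϑ 1) 0# ++ concat (applyUpTo (λ i → map value (replicate (blockLength i) (suc i))) M)
      ≡⟨ cong (λ xss → _ ++ concat xss) (applyUpTo-cong M (λ i →
           trans (map-replicate value (blockLength i) (suc i))
                 (cong (λ k → replicate (part ω (suc i) + k) (a (suc i))) (sym (part-drop-1 ϑ i))))) ⟩
    zList K ϑ ω a ∎)
    where
    open ≡-Reasoning
    M = len ϑ ⊔ len ω
    blockLength : ℕ → ℕ
    blockLength i = part ω (suc i) + part (drop 1 ϑ) (suc i)

module AtZ {c ℓ : Level} (K : CommutativeRing c ℓ) (isField : IsField K)
  {n : ℕ} {ϑ ω : List ℕ} (bp : IsBP n ϑ ω) (a : ℕ → CommutativeRing.Carrier K)
  (a≉0 : ∀ i → 1 ≤ i → i ≤ len ϑ ⊔ len ω →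
    ¬ (CommutativeRing._≈_ K (a i) (CommutativeRing.0# K)))
  (a²-injective : ∀ i j → 1 ≤ i → i ≤ len ϑ ⊔ len ω → 1 ≤ j → j ≤ len ϑ ⊔ len ω → i ≢ j →
    ¬ (CommutativeRing._≈_ K (CommutativeRing._*_ K (a i) (a i)) (CommutativeRing._*_ K (a j) (a j))))
  where
  open CommutativeRing K using (Carrier; _≈_; _*_; 0#; zeroˡ)
    renaming (refl to ≈-refl; sym to ≈-sym; trans to ≈-trans; reflexive to ≈-reflexive)

  m : ℕ
  m = len ϑ ⊔ len ω

  cls : Fin n → ℕ
  cls i = lookupℕ (classList ϑ ω) (toℕ i)

  open Classes cls

  z : Fin n → Carrier
  z = zPoint K n ϑ ω a

  z² : Fin n → Carrier
  z² i = z i * z i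

  z≡value : ∀ i → z i ≡ value K a (cls i)
  z≡value i = trans (cong (λ l → lookup0 K l (toℕ i)) (zList≡map-value K a ϑ ω))
                    (lookup0-map-value K a (classList ϑ ω) (toℕ i))

  z²≡value² : ∀ i → z² i ≡ value K a (cls i) * value K a (cls i)
  z²≡value² i = cong (λ v → v * v) (z≡value i)

  map-cls-allFin : map cls (allFin n) ≡ classList ϑ ω
  map-cls-allFin = trans (map-tabulate id cls)
    (tabulate-lookupℕ (classList ϑ ω) (trans (length-classList ϑ ω) (proj₂ (proj₂ bp))))

  canonical : Filling 0 1 ϑ ω (canonicalT ϑ ω (allFin n)) (canonicalS ϑ ω (allFin n)) (allFin n)
  canonical = canonical-filling ϑ ω (allFin n) map-cls-allFin

  canonicalBitableau : Bitableau n ϑ ω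
  canonicalBitableau = record { shapeT = shapeT ; shapeS = shapeS ; bij = cells }
    where open Filling canonical

  value≉0 : ∀ {k} → 1 ≤ k → k ≤ m → ¬ value K a k ≈ 0#
  value≉0 {suc k} = a≉0 (suc k)

  value²-injective : ∀ {k l} → k < l → l ≤ m → ¬ value K a k * value K a k ≈ value K a l * value K a l
  value²-injective {zero} {suc l} _ l≤m e =
    *-nonzero K isField (value≉0 z<s l≤m) (value≉0 z<s l≤m) (≈-trans (≈-sym e) (zeroˡ 0#))
  value²-injective {suc k} {suc l} k<l l≤m =
    a²-injective (suc k) (suc l) z<s (≤-trans (<⇒≤ k<l) l≤m) z<s l≤m (λ e → <-irrefl e k<l)

  columns-nonzero : ∀ s R → Stratified s R → s + length R ≤ suc m →
    ¬ prod K (map (λ col → Δ K (map z² col)) (columns R)) ≈ 0#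
  columns-nonzero s R strat bound = prod-nonzero K isField _ (columns R) (All-columns⁺ R λ j →
    Δ-nonzero K isField _ (AllPairs.map⁺ (AllPairs.map separated
      (AllPairs-All⁺ (All-column R j (stratified-bounds s R strat)) (column-increasing s R strat j)))))
    where
    separated : ∀ {u w} → cls u < cls w × s ≤ cls w × cls w < s + length R → ¬ z² u ≈ z² w
    separated (u<w , _ , w<) e = value²-injective u<w (≤-pred (≤-trans w< bound))
      (subst₂ _≈_ (z²≡value² _) (z²≡value² _) e)

  canonical-nonvanishing : ¬ sp K canonicalBitableau z ≈ 0#
  canonical-nonvanishing = *-nonzero K isField
    (*-nonzero K isField
      (columns-nonzero 0 T stratifiedT (m≤n⇒m≤1+n lengthT≤m))
      (columns-nonzero 1 S stratifiedS (s≤s lengthS≤m)))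
    (prod-nonzero K isField z (concat S) (All.map entry≉0 (stratified-bounds 1 S stratifiedS)))
    where
    open Filling canonical
    T = canonicalT ϑ ω (allFin n)
    S = canonicalS ϑ ω (allFin n)
    lengthT≤m : length T ≤ m
    lengthT≤m = subst (_≤ m) (trans (cong length (sym shapeT)) (length-map length T)) (m≤m⊔n (len ϑ) (len ω))
    lengthS≤m : length S ≤ m
    lengthS≤m = subst (_≤ m) (trans (cong length (sym shapeS)) (length-map length S)) (m≤n⊔m (len ϑ) (len ω))
    entry≉0 : ∀ {x} → 1 ≤ cls x × cls x < 1 + length S → ¬ z x ≈ 0#
    entry≉0 {x} (pos , bounded) e =
      value≉0 pos (≤-trans (≤-pred bounded) lengthS≤m) (subst (_≈ 0#) (z≡value x) e)

  record Admissible {λ' μ} (B : Bitableau n λ' μ) : Set where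
    open Bitableau B
    field
      distinctT : All Distinct (columns T)
      distinctS : All Distinct (columns S)
      positiveS : All (λ x → 1 ≤ cls x) (concat S)

  distinct-or-vanishing : ∀ col → Distinct col ⊎ Δ K (map z² col) ≈ 0#
  distinct-or-vanishing = Δ-vanishes-unless-AllPairs K z² λ u w → case cls u ≟ cls w of λ where
    (yes e) → inj₂ (≈-reflexive (trans (z²≡value² u)
                      (trans (cong (λ k → value K a k * value K a k) e) (sym (z²≡value² w)))))
    (no ne) → inj₁ ne

  positive-or-vanishing : ∀ x → 1 ≤ cls x ⊎ z x ≈ 0#
  positive-or-vanishing x with cls x in e
  ... | zero  = inj₂ (≈-reflexive (trans (z≡value x) (cong (value K a) e)))
  ... | suc _ = inj₁ (s≤s z≤n)

  admissible-or-vanishing : ∀ {λ' μ} (B : Bitableau n λ' μ) → Admissible B ⊎ sp K B z ≈ 0#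
  admissible-or-vanishing B
    with prod-vanishes-unless-All K _ distinct-or-vanishing (columns (Bitableau.T B))
       | prod-vanishes-unless-All K _ distinct-or-vanishing (columns (Bitableau.S B))
       | prod-vanishes-unless-All K z positive-or-vanishing (concat (Bitableau.S B))
  ... | inj₂ T≈0 | _ | _ = inj₂ (x≈0⇒x*y≈0 K (x≈0⇒x*y≈0 K T≈0))
  ... | inj₁ _ | inj₂ S≈0 | _ = inj₂ (x≈0⇒x*y≈0 K (y≈0⇒x*y≈0 K S≈0))
  ... | inj₁ _ | inj₁ _ | inj₂ entries≈0 = inj₂ (y≈0⇒x*y≈0 K entries≈0)
  ... | inj₁ dT | inj₁ dS | inj₁ pS = inj₁ record { distinctT = dT ; distinctS = dS ; positiveS = pS }

  C : ℕ → ℕ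
  C t = countFrom t (allFin n)

  countFrom-bitableau : ∀ {λ' μ} (B : Bitableau n λ' μ) t →
    countFrom t (concat (Bitableau.T B)) + countFrom t (concat (Bitableau.S B)) ≡ C t
  countFrom-bitableau B t = trans (sym (sumMap-++ _ (concat T) (concat S))) (sumMap-↭ _ bij)
    where open Bitableau B

  dom-canonical : ∀ k → dom ϑ ω (suc k) + C (suc k) ≡ n
  dom-canonical k = begin
    dom ϑ ω (suc k) + C (suc k)
      ≡⟨ cong (dom ϑ ω (suc k) +_) (countFrom-bitableau canonicalBitableau (suc k)) ⟨
    dom ϑ ω (suc k) + (countFrom (suc k) (concat T) + countFrom (suc k) (concat S))
      ≡⟨ cong (dom ϑ ω (suc k) +_) (cong₂ _+_
           (trans (countFrom-stratified 0 T stratifiedT (suc k)) (sumMap-length-drop T shapeT (suc k)))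
           (trans (countFrom-stratified 1 S stratifiedS (suc k)) (sumMap-length-drop S shapeS k))) ⟩
    dom ϑ ω (suc k) + (sum (drop (suc k) ϑ) + sum (drop k ω))
      ≡⟨ dom+tails≡size ϑ ω k ⟩
    size ϑ + size ω
      ≡⟨ proj₂ (proj₂ bp) ⟩
    n ∎
    where
    open ≡-Reasoning
    open Filling canonical
    T = canonicalT ϑ ω (allFin n)
    S = canonicalS ϑ ω (allFin n)

  dom-admissible : ∀ {λ' μ} → IsBP n λ' μ → (B : Bitableau n λ' μ) → Admissible B →
    ∀ k → dom ϑ ω (suc k) ≤ dom λ' μ (suc k)
  dom-admissible {λ'} {μ} bp′ B adm k = +-cancelʳ-≤ (C (suc k)) _ _ (begin
    dom ϑ ω (suc k) + C (suc k)                                ≡⟨ dom-canonical k ⟩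
    n                                                          ≡⟨ proj₂ (proj₂ bp′) ⟨
    size λ' + size μ                                           ≡⟨ dom+tails≡size λ' μ k ⟨
    dom λ' μ (suc k) + (sum (drop (suc k) λ') + sum (drop k μ)) ≤⟨ +-monoʳ-≤ (dom λ' μ (suc k)) tails≤C ⟩
    dom λ' μ (suc k) + C (suc k)                               ∎)
    where
    open ≤-Reasoning
    open Bitableau B
    open Admissible adm
    tails≤C : sum (drop (suc k) λ') + sum (drop k μ) ≤ C (suc k)
    tails≤C = begin
      sum (drop (suc k) λ') + sum (drop k μ)
        ≡⟨ cong₂ _+_ (sumMap-length-drop T shapeT (suc k)) (sumMap-length-drop S shapeS k) ⟨
      sumMap length (drop (suc k) T) + sumMap length (drop k S)
        ≤⟨ +-mono-≤
             (cells-drop≤countFrom T (subst (Linked _≥_) (sym shapeT) (proj₂ (proj₁ bp′)))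
               (λ j<w → All-columns⁻ T distinctT j<w , All.universal (λ _ → z≤n) _) (suc k))
             (cells-drop≤countFrom S (subst (Linked _≥_) (sym shapeS) (proj₂ (proj₁ (proj₂ bp′))))
               (λ {j} j<w → All-columns⁻ S distinctS j<w , All-column S j positiveS) k) ⟩
      countFrom (suc k + 0) (concat T) + countFrom (k + 1) (concat S)
        ≡⟨ cong₂ (λ t u → countFrom t (concat T) + countFrom u (concat S)) (+-identityʳ (suc k)) (+-comm k 1) ⟩
      countFrom (suc k) (concat T) + countFrom (suc k) (concat S)
        ≡⟨ countFrom-bitableau B (suc k) ⟩
      C (suc k) ∎

  -- ¬ InV yields no bitableau constructively, so the inequality is decided first;
  -- if it fails, no bitableau is admissible and every Specht polynomial vanishes.
  dom-bound : ∀ λ' μ → IsBP n λ' μ → ¬ InV K n λ' μ z →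
    ∀ k → 1 ≤ k → dom ϑ ω k ≤ dom λ' μ k
  dom-bound λ' μ bp′ z∉V (suc k) _ with dom ϑ ω (suc k) ≤? dom λ' μ (suc k)
  ... | yes ≤dom = ≤dom
  ... | no ≰dom = ⊥-elim (z∉V λ B →
    [ (λ adm → ⊥-elim (≰dom (dom-admissible bp′ B adm k))) , (λ sp≈0 → sp≈0) ] (admissible-or-vanishing B))

lemma3 : ∀ {c ℓ : Level} (K : CommutativeRing c ℓ) → IsField K → CharZero K →
    (n : ℕ) (ϑ ω : List ℕ) → IsBP n ϑ ω →
    (a : ℕ → CommutativeRing.Carrier K) →
    (∀ i → 1 ≤ i → i ≤ len ϑ ⊔ len ω →
      ¬ (CommutativeRing._≈_ K (a i) (CommutativeRing.0# K))) →
    (∀ i j → 1 ≤ i → i ≤ len ϑ ⊔ len ω → 1 ≤ j → j ≤ len ϑ ⊔ len ω → i ≢ j →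
      ¬ (CommutativeRing._≈_ K (CommutativeRing._*_ K (a i) (a i))
                                (CommutativeRing._*_ K (a j) (a j)))) →
    (¬ InV K n ϑ ω (zPoint K n ϑ ω a))
    × ((λ' μ : List ℕ) → IsBP n λ' μ → ¬ InV K n λ' μ (zPoint K n ϑ ω a) →
        ∀ k → 1 ≤ k → dom ϑ ω k ≤ dom λ' μ k)
lemma3 K isField _ n ϑ ω bp a a≉0 a²-injective =
  (λ z∈V → canonical-nonvanishing (z∈V canonicalBitableau)) , dom-bound
  where open AtZ K isField bp a a≉0 a²-injective
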